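{- Let $X$ be a finite non-empty set and $P\in\mathfrak{P}(X)$. If $P$ has the 3-chain-property, then $P$ is $\mathfrak{L}$-shielded. Moreover, if $P$ has an FPP-graph, then the converse also holds: if $P$ is $\mathfrak{L}$-shielded, then $P$ has the 3-chain-property.
   Context: For a finite non-empty set $X$, $\mathfrak{P}(X)$ is the set of all partial orders (posets) with carrier $X$, ordered by $P\sqsubseteq Q$ iff $\leq_P\subseteq\leq_Q$ (as subsets of $X\times X$); $\mathfrak{L}(P)$ denotes the set of lower covers of $P$ in $(\mathfrak{P}(X),\sqsubseteq)$. For a poset $P$: $<_P$ is the strict order; $[x,y]_P=\{z: x\leq_P z\leq_P y\}$; $x\lessdot_P y$ means $x<_P y$ and $[x,y]_P=\{x,y\}$; $L(P)$ and $U(P)$ are the sets of minimal and maximal elements, $M(P)=X\setminus(L(P)\cup U(P))$; $\prec_P=\{(a,b)\in <_P : M(P)\cap[a,b]_P=\emptyset\}$ (equivalently $\lessdot_P\cap(L(P)\times U(P))$). For $(a,b)\in X\times X$, $P\setminus(a,b)$ denotes $(X,\leq_P\setminus\{(a,b)\})$. $P$ is connected iff its comparability graph is connected. $P$ has an FPP-graph iff $P$ is connected and $P\setminus(a,b)$ is disconnected for every $(a,b)\in\prec_P$. $P$ is $\mathfrak{L}$-shielded iff no poset in $\mathfrak{L}(P)$ has an FPP-graph. A point $p$ is I-retractable to $q$ in $P$ iff $q$ is the maximum of $\{z: z<_P p\}$ or $q$ is the minimum of $\{z : p<_P z\}$. For $(a,b)\in\lessdot_P$ such that $Q:=P\setminus(a,b)$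 is connected, the pair $(a,b)$ has the 3-chain-property iff there exists $(x,y)\in\lessdot_Q$ such that $Q\setminus(x,y)$ is connected and the subposet of $P$ induced on $\{a,b,x,y\}$ is a chain $u\lessdot_P v\lessdot_P w$ with $u\in L(P)$, $w\in U(P)$ (a maximal chain of $P$), satisfying: (i) if $(x,y)\in L(P)\times U(P)$ then $[u,w]_P=\{u,v,w\}$; (ii) if $x\in M(P)$ then $b$ is I-retractable to $a$ in $P$; (iii) if $y\in M(P)$ then $a$ is I-retractable to $b$ in $P$. The poset $P$ has the 3-chain-property iff every $(a,b)\in\lessdot_P$ with $P\setminus(a,b)$ connected has the 3-chain-property. -}

module Defs where

open import Data.Nat using (ℕ; suc)
open import Data.Fin using (Fin; _≟_)
open import Data.Bool using (Bool; true; false; _∧_; not)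
open import Data.Product using (Σ; _×_; _,_; ∃; ∃-syntax)
open import Data.Sum using (_⊎_)
open import Data.Empty using (⊥)
open import Relation.Nullary using (¬_)
open import Relation.Nullary.Decidable using (⌊_⌋)
open import Relation.Binary.PropositionalEquality using (_≡_; _≢_)

-- A binary relation on the finite carrier X = Fin n, given as a subset of
-- X × X (its characteristic function).  "x ≤ y" means  r x y ≡ true.
BRel : ℕ → Set
BRel n = Fin n → Fin n → Bool

module _ {n : ℕ} where

  _∋_≤_ : BRel n → Fin n → Fin n → Set
  r ∋ x ≤ y = r x y ≡ true

  record IsPartialOrder (r : BRel n) : Set where
    field
      refl′   : ∀ x → r ∋ x ≤ x
      antisym : ∀ x y → r ∋ x ≤ y → r ∋ y ≤ x → x ≡ y
      trans′  : ∀ x y z → r ∋ x ≤ y → r ∋ y ≤ z → r ∋ x ≤ z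

record Poset (n : ℕ) : Set where
  constructor mkPoset
  field
    rel  : BRel n
    isPO : IsPartialOrder rel
open Poset public

module _ {n : ℕ} where

  _⊑_ : Poset n → Poset n → Set
  P ⊑ Q = ∀ x y → rel P ∋ x ≤ y → rel Q ∋ x ≤ y

  _⊏_ : Poset n → Poset n → Set
  P ⊏ Q = (P ⊑ Q) × ¬ (Q ⊑ P)

  IsLowerCover : Poset n → Poset n → Set
  IsLowerCover P Q = (Q ⊏ P) × ¬ (Σ (Poset n) λ R → (Q ⊏ R) × (R ⊏ P))

  _∋_<_ : BRel n → Fin n → Fin n → Set
  r ∋ x < y = (r ∋ x ≤ y) × (x ≢ y)

  InInterval : BRel n → Fin n → Fin n → Fin n → Set
  InInterval r x y z = (r ∋ x ≤ z) × (r ∋ z ≤ y)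

  _∋_⋖_ : BRel n → Fin n → Fin n → Set
  r ∋ x ⋖ y = (r ∋ x < y) × (∀ z → InInterval r x y z → (z ≡ x) ⊎ (z ≡ y))

  Minimal : BRel n → Fin n → Set
  Minimal r x = ∀ z → r ∋ z ≤ x → z ≡ x

  Maximal : BRel n → Fin n → Set
  Maximal r x = ∀ z → r ∋ x ≤ z → z ≡ x

  Middle : BRel n → Fin n → Set
  Middle r x = ¬ Minimal r x × ¬ Maximal r x

  _∋_≺_ : BRel n → Fin n → Fin n → Set
  r ∋ a ≺ b = (r ∋ a < b) × (∀ z → Middle r z → ¬ InInterval r a b z)

  remove : BRel n → Fin n → Fin n → BRel n
  remove r a b x y = r x y ∧ not (⌊ x ≟ a ⌋ ∧ ⌊ y ≟ b ⌋)

  Comparable : BRel n → Fin n → Fin n → Set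
  Comparable r x y = (r ∋ x ≤ y) ⊎ (r ∋ y ≤ x)

  data Reach (r : BRel n) : Fin n → Fin n → Set where
    here : ∀ {x} → Reach r x x
    step : ∀ {x y z} → Comparable r x y → Reach r y z → Reach r x z

  Connected : BRel n → Set
  Connected r = ∀ x y → Reach r x y

  HasFPPGraph : Poset n → Set
  HasFPPGraph P = Connected (rel P) ×
    (∀ a b → rel P ∋ a ≺ b → ¬ Connected (remove (rel P) a b))

  LShielded : Poset n → Set
  LShielded P = ∀ Q → IsLowerCover P Q → ¬ HasFPPGraph Q

  IsMaxBelow : BRel n → Fin n → Fin n → Set
  IsMaxBelow r p q = (r ∋ q < p) × (∀ z → r ∋ z < p → r ∋ z ≤ q)

  IsMinAbove : BRel n → Fin n → Fin n → Set
  IsMinAbove r p q = (r ∋ p < q) × (∀ z → r ∋ p < z → r ∋ q ≤ z)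

  IRetractable : BRel n → Fin n → Fin n → Set
  IRetractable r p q = IsMaxBelow r p q ⊎ IsMinAbove r p q

  -- the pair (a,b) has the 3-chain-property in P
  -- (only meaningful when a ⋖_P b and P ∖ (a,b) is connected)
  PairThreeChain : Poset n → Fin n → Fin n → Set
  PairThreeChain P a b =
    let p = rel P ; q = remove p a b in
    ∃[ x ] ∃[ y ]
      (q ∋ x ⋖ y) × Connected (remove q x y) ×
      (∃[ u ] ∃[ v ] ∃[ w ]
        (∀ z → (((z ≡ a) ⊎ (z ≡ b) ⊎ (z ≡ x) ⊎ (z ≡ y)) → ((z ≡ u) ⊎ (z ≡ v) ⊎ (z ≡ w)))
             × (((z ≡ u) ⊎ (z ≡ v) ⊎ (z ≡ w)) → ((z ≡ a) ⊎ (z ≡ b) ⊎ (z ≡ x) ⊎ (z ≡ y)))) ×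
        (p ∋ u ⋖ v) × (p ∋ v ⋖ w) × Minimal p u × Maximal p w ×
        ((Minimal p x × Maximal p y) →
           ∀ z → InInterval p u w z → (z ≡ u) ⊎ (z ≡ v) ⊎ (z ≡ w)) ×
        (Middle p x → IRetractable p b a) ×
        (Middle p y → IRetractable p a b))

  ThreeChainProperty : Poset n → Set
  ThreeChainProperty P = ∀ a b → rel P ∋ a ⋖ b →
    Connected (remove (rel P) a b) → PairThreeChain P a b

-- The lower covers of P are exactly the posets P ∖ (a,b) with a ⋖ b, and such a Q has no
-- FPP-graph iff it is disconnected or some (c,d) ∈ ≺_Q leaves Q ∖ (c,d) connected.
-- A 3-chain witness (x,y) for (a,b) is such a pair: conditions (ii) and (iii) keep x minimal
-- and y maximal once (a,b) is removed.  Conversely, if P has an FPP-graph, Q = P ∖ (a,b) is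
-- connected and has none, pick (c,d) ∈ ≺_Q with Q ∖ (c,d) connected.  It is not in ≺_P, so
-- either a or b lies strictly inside [c,d]_P, or (a,b) ends at c or starts at d; in each case
-- {a,b,c,d} is a maximal 3-chain of P.
module Submission where

open import Defs
open import Data.Nat using (ℕ; suc)
open import Data.Bool using (true)
open import Data.Bool.Properties using () renaming (_≟_ to _≟ᵇ_)
open import Data.Fin using (Fin; _≟_)
open import Data.Fin.Properties using (any?; all?)
open import Data.Fin.Induction using (po-wellFounded; po-noetherian)
open import Data.Fin.Subset using (Subset; _∈_; _∉_; _⊃_; _∪_; ⁅_⁆)
open import Data.Fin.Subset.Properties using (_∈?_; x∈⁅x⁆; x∈⁅y⁆⇒x≡y; p⊆p∪q; q⊆p∪q; x∈p∪q⁻)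
open import Data.Fin.Subset.Induction using (⊃-wellFounded)
open import Data.Product using (Σ; _×_; _,_; proj₁; proj₂; ∃; ∃₂)
open import Data.Sum using (_⊎_; inj₁; inj₂; [_,_])
open import Data.Empty using (⊥; ⊥-elim)
open import Induction.WellFounded using (Acc; acc)
open import Relation.Nullary using (¬_; Dec; yes; no)
open import Relation.Nullary.Decidable using (_×-dec_; _⊎-dec_; _→-dec_; ¬?; map′; decidable-stable)
open import Relation.Binary.PropositionalEquality using (_≡_; _≢_; refl; sym; trans; subst; isEquivalence)
import Relation.Binary.Structures as Std

module _ {n : ℕ} (r : BRel n) (a b : Fin n) where

  remove-⊆ : ∀ {x y} → remove r a b ∋ x ≤ y → r ∋ x ≤ y
  remove-⊆ {x} {y} x≤y with r x y
  ... | true = refl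

  remove-∌ : ∀ {x y} → remove r a b ∋ x ≤ y → ¬ (x ≡ a × y ≡ b)
  remove-∌ x≤y (refl , refl) with r a b | a ≟ a | b ≟ b
  remove-∌ () _ | true | yes _ | yes _
  remove-∌ _ _ | true | no a≢a | _ = a≢a refl
  remove-∌ _ _ | true | yes _ | no b≢b = b≢b refl

  remove⁺ : ∀ {x y} → r ∋ x ≤ y → ¬ (x ≡ a × y ≡ b) → remove r a b ∋ x ≤ y
  remove⁺ {x} {y} x≤y ≢ab rewrite x≤y with x ≟ a | y ≟ b
  ... | no _ | _ = refl
  ... | yes _ | no _ = refl
  ... | yes x≡a | yes y≡b = ⊥-elim (≢ab (x≡a , y≡b))

  remove-⊎ : ∀ {x y} → r ∋ x ≤ y → (x ≡ a × y ≡ b) ⊎ (remove r a b ∋ x ≤ y)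
  remove-⊎ {x} {y} x≤y with (x ≟ a) ×-dec (y ≟ b)
  ... | yes removed = inj₁ removed
  ... | no kept = inj₂ (remove⁺ x≤y kept)

  remove-∉ : ∀ {x y} → r ∋ x ≤ y → ¬ (remove r a b ∋ x ≤ y) → x ≡ a × y ≡ b
  remove-∉ x≤y x≰y with remove-⊎ x≤y
  ... | inj₁ removed = removed
  ... | inj₂ x≤′y = ⊥-elim (x≰y x≤′y)

  Minimal-remove : ∀ {x} → b ≢ x → Minimal (remove r a b) x → Minimal r x
  Minimal-remove b≢x min z z≤x = min z (remove⁺ z≤x (λ (_ , x≡b) → b≢x (sym x≡b)))

  Maximal-remove : ∀ {x} → a ≢ x → Maximal (remove r a b) x → Maximal r x
  Maximal-remove a≢x max z x≤z = max z (remove⁺ x≤z (λ (x≡a , _) → a≢x (sym x≡a)))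

module _ {n : ℕ} (r : BRel n) where

  ≤? : ∀ x y → Dec (r ∋ x ≤ y)
  ≤? x y = r x y ≟ᵇ true

  <? : ∀ x y → Dec (r ∋ x < y)
  <? x y = ≤? x y ×-dec ¬? (x ≟ y)

  Minimal? : ∀ x → Dec (Minimal r x)
  Minimal? x = all? λ z → ≤? z x →-dec (z ≟ x)

  Maximal? : ∀ x → Dec (Maximal r x)
  Maximal? x = all? λ z → ≤? x z →-dec (z ≟ x)

  ≺? : ∀ x y → Dec (r ∋ x ≺ y)
  ≺? x y = <? x y ×-dec all? λ z →
    (¬? (Minimal? z) ×-dec ¬? (Maximal? z)) →-dec ¬? (≤? x z ×-dec ≤? z y)

  Comparable? : ∀ x y → Dec (Comparable r x y)
  Comparable? x y = ≤? x y ⊎-dec ≤? y x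

  <⇒¬Minimal : ∀ {x y} → r ∋ x < y → ¬ Minimal r y
  <⇒¬Minimal (x≤y , x≢y) min = x≢y (min _ x≤y)

  <⇒¬Maximal : ∀ {x y} → r ∋ x < y → ¬ Maximal r x
  <⇒¬Maximal (x≤y , x≢y) max = x≢y (sym (max _ x≤y))

  Minimal-or-∃< : ∀ x → Minimal r x ⊎ ∃ λ z → r ∋ z < x
  Minimal-or-∃< x with any? (λ z → <? z x)
  ... | yes below = inj₂ below
  ... | no none = inj₁ λ z z≤x → decidable-stable (z ≟ x) (λ z≢x → none (z , z≤x , z≢x))

  Maximal-or-∃> : ∀ x → Maximal r x ⊎ ∃ λ z → r ∋ x < z
  Maximal-or-∃> x with any? (λ z → <? x z)
  ... | yes above = inj₂ above
  ... | no none = inj₁ λ z x≤z → decidable-stable (z ≟ x) (λ z≢x → none (z , x≤z , λ x≡z → z≢x (sym x≡z)))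

  ⋖∧Minimal∧Maximal⇒≺ : ∀ {x y} → r ∋ x ⋖ y → Minimal r x → Maximal r y → r ∋ x ≺ y
  ⋖∧Minimal∧Maximal⇒≺ (x<y , endpoints) min max = x<y , λ z (¬min , ¬max) z∈[x,y] →
    [ (λ { refl → ¬min min }) , (λ { refl → ¬max max }) ] (endpoints z z∈[x,y])

module _ {n : ℕ} where

  _⊆ʳ_ : BRel n → BRel n → Set
  r ⊆ʳ s = ∀ x y → r ∋ x ≤ y → s ∋ x ≤ y

  remove-mono : ∀ {r s} → r ⊆ʳ s → ∀ a b → remove r a b ⊆ʳ remove s a b
  remove-mono {r} {s} r⊆s a b x y x≤y = remove⁺ s a b (r⊆s x y (remove-⊆ r a b x≤y)) (remove-∌ r a b x≤y)

  Reach-mono : ∀ {r s} → r ⊆ʳ s → ∀ {x y} → Reach r x y → Reach s x y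
  Reach-mono r⊆s here = here
  Reach-mono r⊆s (step (inj₁ x≤y) path) = step (inj₁ (r⊆s _ _ x≤y)) (Reach-mono r⊆s path)
  Reach-mono r⊆s (step (inj₂ y≤x) path) = step (inj₂ (r⊆s _ _ y≤x)) (Reach-mono r⊆s path)

  Connected-mono : ∀ {r s} → r ⊆ʳ s → Connected r → Connected s
  Connected-mono r⊆s conn x y = Reach-mono r⊆s (conn x y)

  Minimal-antimono : ∀ {r s} → r ⊆ʳ s → ∀ {x} → Minimal s x → Minimal r x
  Minimal-antimono r⊆s min z z≤x = min z (r⊆s z _ z≤x)

  Maximal-antimono : ∀ {r s} → r ⊆ʳ s → ∀ {x} → Maximal s x → Maximal r x
  Maximal-antimono r⊆s max z x≤z = max z (r⊆s _ z x≤z)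

  ≺-cong : ∀ {r s} → r ⊆ʳ s → s ⊆ʳ r → ∀ {x y} → r ∋ x ≺ y → s ∋ x ≺ y
  ≺-cong r⊆s s⊆r ((x≤y , x≢y) , noMiddle) =
    (r⊆s _ _ x≤y , x≢y) , λ z (¬min , ¬max) (x≤z , z≤y) →
      noMiddle z ((λ min → ¬min (Minimal-antimono s⊆r min)) , (λ max → ¬max (Maximal-antimono s⊆r max)))
               (s⊆r _ _ x≤z , s⊆r _ _ z≤y)

  HasFPPGraph-cong : ∀ {P Q : Poset n} → P ⊑ Q → Q ⊑ P → HasFPPGraph P → HasFPPGraph Q
  HasFPPGraph-cong P⊑Q Q⊑P (conn , separating) =
    Connected-mono P⊑Q conn ,
    λ a b a≺b conn′ → separating a b (≺-cong Q⊑P P⊑Q a≺b) (Connected-mono (remove-mono Q⊑P a b) conn′)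

module _ {n : ℕ} (r : BRel n) where

  Reach-snoc : ∀ {x y z} → Reach r x y → Comparable r y z → Reach r x z
  Reach-snoc here y~z = step y~z here
  Reach-snoc (step x~w path) y~z = step x~w (Reach-snoc path y~z)

  ComparabilityClosed : Subset n → Set
  ComparabilityClosed S = ∀ {w z} → w ∈ S → Comparable r w z → z ∈ S

  Reach-closed : ∀ {S} → ComparabilityClosed S → ∀ {x y} → x ∈ S → Reach r x y → y ∈ S
  Reach-closed closed x∈S here = x∈S
  Reach-closed closed x∈S (step x~w path) = Reach-closed closed (closed x∈S x~w) path

  ComparabilityClosed-or-∃edgeOut : ∀ S → ComparabilityClosed S ⊎ ∃₂ λ w z → w ∈ S × z ∉ S × Comparable r w z
  ComparabilityClosed-or-∃edgeOut S with any? (λ w → any? λ z → (w ∈? S) ×-dec ¬? (z ∈? S) ×-dec Comparable? r w z)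
  ... | yes (w , z , edgeOut) = inj₂ (w , z , edgeOut)
  ... | no none = inj₁ λ {w} {z} w∈S w~z →
    decidable-stable (z ∈? S) (λ z∉S → none (w , z , w∈S , z∉S , w~z))

  -- Grow a set of points reachable from x until it is closed under comparability.
  Reach? : ∀ x y → Dec (Reach r x y)
  Reach? x y = explore ⁅ x ⁆ (⊃-wellFounded ⁅ x ⁆) (x∈⁅x⁆ x)
                 (λ {z} z∈⁅x⁆ → subst (Reach r x) (sym (x∈⁅y⁆⇒x≡y x z∈⁅x⁆)) here)
    where
    explore : ∀ S → Acc _⊃_ S → x ∈ S → (∀ {z} → z ∈ S → Reach r x z) → Dec (Reach r x y)
    explore S (acc larger) x∈S reachable with ComparabilityClosed-or-∃edgeOut S
    ... | inj₁ closed = map′ reachable (Reach-closed closed x∈S) (y ∈? S)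
    ... | inj₂ (w , z , w∈S , z∉S , w~z) =
      explore (S ∪ ⁅ z ⁆) (larger S⊂S∪z) (p⊆p∪q ⁅ z ⁆ x∈S) reachable′
      where
      S⊂S∪z : (S ∪ ⁅ z ⁆) ⊃ S
      S⊂S∪z = p⊆p∪q ⁅ z ⁆ , z , q⊆p∪q S ⁅ z ⁆ (x∈⁅x⁆ z) , z∉S
      reachable′ : ∀ {t} → t ∈ S ∪ ⁅ z ⁆ → Reach r x t
      reachable′ t∈ with x∈p∪q⁻ S ⁅ z ⁆ t∈
      ... | inj₁ t∈S = reachable t∈S
      ... | inj₂ t∈⁅z⁆ rewrite x∈⁅y⁆⇒x≡y z t∈⁅z⁆ = Reach-snoc (reachable w∈S) w~z

  Connected? : Dec (Connected r)
  Connected? = all? λ x → all? λ y → Reach? x y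

module PosetProperties {n : ℕ} (P : Poset n) where
  private
    p : BRel n
    p = rel P
  open IsPartialOrder (isPO P)

  ≤-isPartialOrder : Std.IsPartialOrder _≡_ (λ x y → p ∋ x ≤ y)
  ≤-isPartialOrder = record
    { isPreorder = record
      { isEquivalence = isEquivalence
      ; reflexive = λ { {x} refl → refl′ x }
      ; trans = λ {x} {y} {z} → trans′ x y z
      }
    ; antisym = λ {x} {y} → antisym x y
    }

  <⇒≱ : ∀ {x y} → p ∋ x < y → ¬ (p ∋ y ≤ x)
  <⇒≱ (x≤y , x≢y) y≤x = x≢y (antisym _ _ x≤y y≤x)

  <-trans : ∀ {x y z} → p ∋ x < y → p ∋ y < z → p ∋ x < z
  <-trans (x≤y , x≢y) y<z@(y≤z , _) =
    trans′ _ _ _ x≤y y≤z , λ { refl → <⇒≱ y<z x≤y }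

  <∧noInner⇒⋖ : ∀ {x y} → p ∋ x < y → (∀ {z} → p ∋ x < z → p ∋ z < y → ⊥) → p ∋ x ⋖ y
  <∧noInner⇒⋖ {x} {y} x<y noInner = x<y , endpoint
    where
    endpoint : ∀ z → InInterval p x y z → (z ≡ x) ⊎ (z ≡ y)
    endpoint z (x≤z , z≤y) with z ≟ x | z ≟ y
    ... | yes z≡x | _ = inj₁ z≡x
    ... | no _ | yes z≡y = inj₂ z≡y
    ... | no z≢x | no z≢y = ⊥-elim (noInner (x≤z , λ x≡z → z≢x (sym x≡z)) (z≤y , z≢y))

  ⋖-or-between : ∀ {x y} → p ∋ x < y → (p ∋ x ⋖ y) ⊎ ∃ λ z → p ∋ x < z × p ∋ z < y
  ⋖-or-between {x} {y} x<y with any? (λ z → <? p x z ×-dec <? p z y)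
  ... | yes between = inj₂ between
  ... | no none = inj₁ (<∧noInner⇒⋖ x<y λ x<z z<y → none (_ , x<z , z<y))

  ≺⇒⋖ : ∀ {x y} → p ∋ x ≺ y → p ∋ x ⋖ y
  ≺⇒⋖ (x<y , noMiddle) = <∧noInner⇒⋖ x<y λ x<z z<y →
    noMiddle _ (<⇒¬Minimal p x<z , <⇒¬Maximal p z<y) (proj₁ x<z , proj₁ z<y)

  ≺⇒Minimal : ∀ {x y} → p ∋ x ≺ y → Minimal p x
  ≺⇒Minimal {x} (x<y@(x≤y , _) , noMiddle) z z≤x = decidable-stable (z ≟ x) λ z≢x →
    noMiddle x (<⇒¬Minimal p (z≤x , z≢x) , <⇒¬Maximal p x<y) (refl′ x , x≤y)

  ≺⇒Maximal : ∀ {x y} → p ∋ x ≺ y → Maximal p y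
  ≺⇒Maximal {y = y} (x<y@(x≤y , _) , noMiddle) z y≤z = decidable-stable (z ≟ y) λ z≢y →
    noMiddle y (<⇒¬Minimal p x<y , <⇒¬Maximal p (y≤z , λ y≡z → z≢y (sym y≡z))) (x≤y , refl′ y)

  -- Lexicographic descent: shrink the interval [x,y] from above (y decreases) or from below (x increases).
  <-outside⇒⋖-outside : ∀ (Q : Poset n) {x y} → p ∋ x < y → ¬ (rel Q ∋ x ≤ y) →
    ∃₂ λ a b → p ∋ a ⋖ b × ¬ (rel Q ∋ a ≤ b)
  <-outside⇒⋖-outside Q {x} {y} = descend (po-wellFounded ≤-isPartialOrder y) (po-noetherian ≤-isPartialOrder x)
    where
    open IsPartialOrder (isPO Q) renaming (trans′ to Q-trans)
    Result : Set
    Result = ∃₂ λ a b → p ∋ a ⋖ b × ¬ (rel Q ∋ a ≤ b)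
    Below Above : Fin n → Fin n → Set
    Below s t = p ∋ s < t
    Above s t = p ∋ t < s

    descend : ∀ {x y} → Acc Below y → Acc Above x → p ∋ x < y → ¬ (rel Q ∋ x ≤ y) → Result
    split : ∀ {x y} → Acc Below y → Acc Above x → ¬ (rel Q ∋ x ≤ y) →
      (p ∋ x ⋖ y) ⊎ (∃ λ z → p ∋ x < z × p ∋ z < y) → Result
    narrow : ∀ {x y z} → Acc Below y → Acc Above x → p ∋ x < z → p ∋ z < y → ¬ (rel Q ∋ x ≤ y) →
      Dec (rel Q ∋ x ≤ z) → Result

    descend accY accX x<y x≰y = split accY accX x≰y (⋖-or-between x<y)

    split _ _ x≰y (inj₁ x⋖y) = _ , _ , x⋖y , x≰y
    split {x} accY accX x≰y (inj₂ (z , x<z , z<y)) = narrow accY accX x<z z<y x≰y (≤? (rel Q) x z)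

    narrow {x} (acc below) _ x<z z<y _ (no x≰z) =
      descend (below z<y) (po-noetherian ≤-isPartialOrder x) x<z x≰z
    narrow accY (acc above) x<z z<y x≰y (yes x≤z) =
      descend accY (above x<z) z<y λ z≤y → x≰y (Q-trans _ _ _ x≤z z≤y)

module _ {n : ℕ} (P : Poset n) {a b : Fin n} (a⋖b : rel P ∋ a ⋖ b) where
  private
    p q : BRel n
    p = rel P
    q = remove p a b
  open IsPartialOrder (isPO P)

  -- If x ≤ y ≤ z lost (x,z) = (a,b), then y ∈ [a,b] = {a,b} and one of the two steps is (a,b).
  remove-trans : ∀ x y z → q ∋ x ≤ y → q ∋ y ≤ z → q ∋ x ≤ z
  remove-trans x y z x≤y y≤z = remove⁺ p a b (trans′ x y z (remove-⊆ p a b x≤y) (remove-⊆ p a b y≤z)) removed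
    where
    removed : ¬ (x ≡ a × z ≡ b)
    removed (refl , refl) with proj₂ a⋖b y (remove-⊆ p a b x≤y , remove-⊆ p a b y≤z)
    ... | inj₁ y≡a = remove-∌ p a b y≤z (y≡a , refl)
    ... | inj₂ y≡b = remove-∌ p a b x≤y (refl , y≡b)

  removeCover : Poset n
  removeCover = mkPoset q record
    { refl′ = λ x → remove⁺ p a b (refl′ x) λ (x≡a , x≡b) → proj₂ (proj₁ a⋖b) (trans (sym x≡a) x≡b)
    ; antisym = λ x y x≤y y≤x → antisym x y (remove-⊆ p a b x≤y) (remove-⊆ p a b y≤x)
    ; trans′ = remove-trans
    }

  removeCover-isLowerCover : IsLowerCover P removeCover
  removeCover-isLowerCover = (removeCover⊑P , P⋢removeCover) , noneBetween
    where
    removeCover⊑P : removeCover ⊑ P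
    removeCover⊑P _ _ = remove-⊆ p a b
    P⋢removeCover : ¬ (P ⊑ removeCover)
    P⋢removeCover P⊑removeCover = remove-∌ p a b (P⊑removeCover a b (proj₁ (proj₁ a⋖b))) (refl , refl)
    noneBetween : ¬ (Σ (Poset n) λ R → (removeCover ⊏ R) × (R ⊏ P))
    noneBetween (R , (removeCover⊑R , R⋢removeCover) , (R⊑P , P⋢R)) with ≤? (rel R) a b
    ... | yes a≤ᴿb = P⋢R λ x y x≤y → [ (λ { (refl , refl) → a≤ᴿb }) , removeCover⊑R x y ] (remove-⊎ p a b x≤y)
    ... | no a≰ᴿb = R⋢removeCover λ x y x≤y → remove⁺ p a b (R⊑P x y x≤y) λ { (refl , refl) → a≰ᴿb x≤y }

module _ {n : ℕ} (P : Poset n) where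
  private
    p : BRel n
    p = rel P
  open PosetProperties P

  ∃≰⇒∃⋖-outside : ∀ Q → ¬ (P ⊑ Q) → ∃₂ λ a b → p ∋ a ⋖ b × ¬ (rel Q ∋ a ≤ b)
  ∃≰⇒∃⋖-outside Q P⋢Q with any? (λ x → any? λ y → ≤? p x y ×-dec ¬? (≤? (rel Q) x y))
  ... | yes (x , y , x≤y , x≰ᵠy) =
    <-outside⇒⋖-outside Q (x≤y , λ { refl → x≰ᵠy (IsPartialOrder.refl′ (isPO Q) x) }) x≰ᵠy
  ... | no none = ⊥-elim (P⋢Q λ x y x≤y → decidable-stable (≤? (rel Q) x y) λ x≰y → none (x , y , x≤y , x≰y))

  IsLowerCover⇒removeCover : ∀ Q → IsLowerCover P Q →
    ∃₂ λ a b → Σ (p ∋ a ⋖ b) λ a⋖b → (Q ⊑ removeCover P a⋖b) × (removeCover P a⋖b ⊑ Q)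
  IsLowerCover⇒removeCover Q ((Q⊑P , P⋢Q) , noneBetween) with ∃≰⇒∃⋖-outside Q P⋢Q
  ... | a , b , a⋖b , a≰ᵠb = a , b , a⋖b , Q⊑R , R⊑Q
    where
    R : Poset n
    R = removeCover P a⋖b
    Q⊑R : Q ⊑ R
    Q⊑R s t s≤t = remove⁺ p a b (Q⊑P s t s≤t) λ { (refl , refl) → a≰ᵠb s≤t }
    R⊑Q : R ⊑ Q
    R⊑Q s t s≤t = decidable-stable (≤? (rel Q) s t) λ s≰t →
      noneBetween (R , (Q⊑R , λ R⊑Q → s≰t (R⊑Q s t s≤t)) , proj₁ (removeCover-isLowerCover P a⋖b))

module _ {n : ℕ} where

  OneOf₃ : Fin n → Fin n → Fin n → Fin n → Set
  OneOf₃ u v w z = (z ≡ u) ⊎ (z ≡ v) ⊎ (z ≡ w)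

  OneOf₄ : Fin n → Fin n → Fin n → Fin n → Fin n → Set
  OneOf₄ a b x y z = (z ≡ a) ⊎ (z ≡ b) ⊎ (z ≡ x) ⊎ (z ≡ y)

  sameElements : ∀ {a b x y u v w} →
    OneOf₃ u v w a → OneOf₃ u v w b → OneOf₃ u v w x → OneOf₃ u v w y →
    OneOf₄ a b x y u → OneOf₄ a b x y v → OneOf₄ a b x y w →
    ∀ z → (OneOf₄ a b x y z → OneOf₃ u v w z) × (OneOf₃ u v w z → OneOf₄ a b x y z)
  sameElements a∈ b∈ x∈ y∈ u∈ v∈ w∈ z =
    (λ { (inj₁ refl) → a∈ ; (inj₂ (inj₁ refl)) → b∈ ; (inj₂ (inj₂ (inj₁ refl))) → x∈ ; (inj₂ (inj₂ (inj₂ refl))) → y∈ }) ,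
    (λ { (inj₁ refl) → u∈ ; (inj₂ (inj₁ refl)) → v∈ ; (inj₂ (inj₂ refl)) → w∈ })

  ¬HasFPPGraph⇒∃≺-nonseparating : ∀ (Q : Poset n) → ¬ HasFPPGraph Q → Connected (rel Q) →
    ∃₂ λ c d → rel Q ∋ c ≺ d × Connected (remove (rel Q) c d)
  ¬HasFPPGraph⇒∃≺-nonseparating Q ¬fpp conn
    with any? (λ c → any? λ d → ≺? (rel Q) c d ×-dec Connected? (remove (rel Q) c d))
  ... | yes nonseparating = nonseparating
  ... | no none = ⊥-elim (¬fpp (conn , λ c d c≺d conn′ → none (c , d , c≺d , conn′)))

module MaximalChain {n : ℕ} (P : Poset n) {u v w : Fin n}
  (u⋖v : rel P ∋ u ⋖ v) (v⋖w : rel P ∋ v ⋖ w) (minU : Minimal (rel P) u) (maxW : Maximal (rel P) w) where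
  private
    p : BRel n
    p = rel P
  open PosetProperties P

  OnChain : Fin n → Set
  OnChain = OneOf₃ u v w

  Middle⇒≡v : ∀ {z} → OnChain z → Middle p z → z ≡ v
  Middle⇒≡v (inj₁ refl) (¬min , _) = ⊥-elim (¬min minU)
  Middle⇒≡v (inj₂ (inj₁ z≡v)) _ = z≡v
  Middle⇒≡v (inj₂ (inj₂ refl)) (_ , ¬max) = ⊥-elim (¬max maxW)

  <-onChain : ∀ {s t} → OnChain s → OnChain t → p ∋ s < t →
    (s ≡ u × t ≡ v) ⊎ (s ≡ v × t ≡ w) ⊎ (s ≡ u × t ≡ w)
  <-onChain _ (inj₁ refl) s<u = ⊥-elim (<⇒¬Minimal p s<u minU)
  <-onChain (inj₂ (inj₂ refl)) _ w<t = ⊥-elim (<⇒¬Maximal p w<t maxW)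
  <-onChain (inj₁ s≡u) (inj₂ (inj₁ t≡v)) _ = inj₁ (s≡u , t≡v)
  <-onChain (inj₁ s≡u) (inj₂ (inj₂ t≡w)) _ = inj₂ (inj₂ (s≡u , t≡w))
  <-onChain (inj₂ (inj₁ refl)) (inj₂ (inj₁ refl)) (_ , v≢v) = ⊥-elim (v≢v refl)
  <-onChain (inj₂ (inj₁ s≡v)) (inj₂ (inj₂ t≡w)) _ = inj₂ (inj₁ (s≡v , t≡w))

  ⋖-onChain : ∀ {s t} → OnChain s → OnChain t → p ∋ s ⋖ t → (s ≡ u × t ≡ v) ⊎ (s ≡ v × t ≡ w)
  ⋖-onChain onS onT s⋖t@(s<t , _) with <-onChain onS onT s<t
  ... | inj₁ uv = inj₁ uv
  ... | inj₂ (inj₁ vw) = inj₂ vw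
  ... | inj₂ (inj₂ (refl , refl)) = ⊥-elim
    ([ (λ v≡u → proj₂ (proj₁ u⋖v) (sym v≡u)) , proj₂ (proj₁ v⋖w) ] (proj₂ s⋖t v (proj₁ (proj₁ u⋖v) , proj₁ (proj₁ v⋖w))))

  <-from-v : ∀ {t} → OnChain t → p ∋ v < t → t ≡ w
  <-from-v onT v<t with <-onChain (inj₂ (inj₁ refl)) onT v<t
  ... | inj₁ (v≡u , _) = ⊥-elim (proj₂ (proj₁ u⋖v) (sym v≡u))
  ... | inj₂ (inj₁ (_ , t≡w)) = t≡w
  ... | inj₂ (inj₂ (v≡u , _)) = ⊥-elim (proj₂ (proj₁ u⋖v) (sym v≡u))

  <-to-v : ∀ {s} → OnChain s → p ∋ s < v → s ≡ u
  <-to-v onS s<v with <-onChain onS (inj₂ (inj₁ refl)) s<v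
  ... | inj₁ (s≡u , _) = s≡u
  ... | inj₂ (inj₁ (_ , v≡w)) = ⊥-elim (proj₂ (proj₁ v⋖w) v≡w)
  ... | inj₂ (inj₂ (s≡u , _)) = s≡u

module _ {n : ℕ} (P : Poset n) {a b : Fin n} (a⋖b : rel P ∋ a ⋖ b) where
  private
    p q : BRel n
    p = rel P
    q = remove p a b
  open PosetProperties P

  -- If x were not minimal after removing (a,b), it would be the middle v of the chain,
  -- (a,b) would be (u,v) and the retraction of b to a forces the removed pair below x.
  PairThreeChain⇒¬HasFPPGraph : PairThreeChain P a b → ¬ HasFPPGraph (removeCover P a⋖b)
  PairThreeChain⇒¬HasFPPGraph
    (x , y , x⋖y , conn , u , v , w , sameElements , u⋖v , v⋖w , minU , maxW , _ , retractB , retractA)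
    (_ , separating) =
    separating x y (⋖∧Minimal∧Maximal⇒≺ q x⋖y minX maxY) conn
    where
    open MaximalChain P u⋖v v⋖w minU maxW
    onA : OnChain a
    onA = proj₁ (sameElements a) (inj₁ refl)
    onB : OnChain b
    onB = proj₁ (sameElements b) (inj₂ (inj₁ refl))
    onX : OnChain x
    onX = proj₁ (sameElements x) (inj₂ (inj₂ (inj₁ refl)))
    onY : OnChain y
    onY = proj₁ (sameElements y) (inj₂ (inj₂ (inj₂ refl)))
    x<y : p ∋ x < y
    x<y = remove-⊆ p a b (proj₁ (proj₁ x⋖y)) , proj₂ (proj₁ x⋖y)
    xy≢ab : ¬ (x ≡ a × y ≡ b)
    xy≢ab = remove-∌ p a b (proj₁ (proj₁ x⋖y))

    minX : Minimal q x
    minX z z≤x = decidable-stable (z ≟ x) λ z≢x → belowX (remove-⊆ p a b z≤x , z≢x)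
      where
      belowX : p ∋ z < x → ⊥
      belowX z<x = go (Middle⇒≡v onX midX) (⋖-onChain onA onB a⋖b)
        where
        midX : Middle p x
        midX = <⇒¬Minimal p z<x , <⇒¬Maximal p x<y
        go : x ≡ v → (a ≡ u × b ≡ v) ⊎ (a ≡ v × b ≡ w) → ⊥
        go refl (inj₂ (refl , refl)) = xy≢ab (refl , <-from-v onY x<y)
        go refl (inj₁ (refl , refl)) with retractB midX
        ... | inj₁ (_ , maxBelow) = remove-∌ p a b z≤x (minU z (maxBelow z z<x) , refl)
        ... | inj₂ (b<a , _) = <⇒≱ b<a (proj₁ (proj₁ a⋖b))

    maxY : Maximal q y
    maxY z y≤z = decidable-stable (z ≟ y) λ z≢y → aboveY (remove-⊆ p a b y≤z , λ y≡z → z≢y (sym y≡z))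
      where
      aboveY : p ∋ y < z → ⊥
      aboveY y<z = go (Middle⇒≡v onY midY) (⋖-onChain onA onB a⋖b)
        where
        midY : Middle p y
        midY = <⇒¬Minimal p x<y , <⇒¬Maximal p y<z
        go : y ≡ v → (a ≡ u × b ≡ v) ⊎ (a ≡ v × b ≡ w) → ⊥
        go refl (inj₁ (refl , refl)) = xy≢ab (<-to-v onX x<y , refl)
        go refl (inj₂ (refl , refl)) with retractA midY
        ... | inj₁ (b<a , _) = <⇒≱ b<a (proj₁ (proj₁ v⋖w))
        ... | inj₂ (_ , minAbove) = remove-∌ p a b y≤z (refl , maxW z (minAbove z y<z))

module _ {n : ℕ} (P : Poset n) {a b : Fin n} (a⋖b : rel P ∋ a ⋖ b) where
  private
    p q : BRel n
    p = rel P
    q = remove p a b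
    a<b : p ∋ a < b
    a<b = proj₁ a⋖b
    a≤b : p ∋ a ≤ b
    a≤b = proj₁ a<b
    a≢b : a ≢ b
    a≢b = proj₂ a<b
  open IsPartialOrder (isPO P)
  open PosetProperties P

  module NonseparatingPair {c d : Fin n} (c≺d : q ∋ c ≺ d) (conn : Connected (remove q c d)) where
    open PosetProperties (removeCover P a⋖b) using ()
      renaming (≺⇒⋖ to ≺ᵠ⇒⋖ᵠ; ≺⇒Minimal to ≺ᵠ⇒Minimalᵠ; ≺⇒Maximal to ≺ᵠ⇒Maximalᵠ)
    c⋖ᵠd : q ∋ c ⋖ d
    c⋖ᵠd = ≺ᵠ⇒⋖ᵠ c≺d
    minᵠc : Minimal q c
    minᵠc = ≺ᵠ⇒Minimalᵠ c≺d
    maxᵠd : Maximal q d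
    maxᵠd = ≺ᵠ⇒Maximalᵠ c≺d
    c<d : p ∋ c < d
    c<d = remove-⊆ p a b (proj₁ (proj₁ c⋖ᵠd)) , proj₂ (proj₁ c⋖ᵠd)

    interval : ∀ {t} → InInterval p c d t → (t ≡ c) ⊎ (t ≡ d) ⊎ (c ≡ a × t ≡ b) ⊎ (t ≡ a × d ≡ b)
    interval (c≤t , t≤d) with remove-⊎ p a b c≤t | remove-⊎ p a b t≤d
    ... | inj₁ removed | _ = inj₂ (inj₂ (inj₁ removed))
    ... | inj₂ _ | inj₁ removed = inj₂ (inj₂ (inj₂ removed))
    ... | inj₂ c≤ᵠt | inj₂ t≤ᵠd = [ inj₁ , (λ t≡d → inj₂ (inj₁ t≡d)) ] (proj₂ c⋖ᵠd _ (c≤ᵠt , t≤ᵠd))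

    chain-abd-c≡a : c ≡ a → p ∋ b < d → PairThreeChain P a b
    chain-abd-c≡a refl b<d =
      c , d , c⋖ᵠd , conn , c , b , d ,
      sameElements (inj₁ refl) (inj₂ (inj₁ refl)) (inj₁ refl) (inj₂ (inj₂ refl))
                   (inj₁ refl) (inj₂ (inj₁ refl)) (inj₂ (inj₂ (inj₂ refl))) ,
      a⋖b , b⋖d , minC , maxD , (λ _ _ → onChain) , (λ (¬min , _) → ⊥-elim (¬min minC)) , (λ (_ , ¬max) → ⊥-elim (¬max maxD))
      where
      onChain : ∀ {t} → InInterval p c d t → OneOf₃ c b d t
      onChain t∈ with interval t∈
      ... | inj₁ t≡c = inj₁ t≡c
      ... | inj₂ (inj₁ t≡d) = inj₂ (inj₂ t≡d)
      ... | inj₂ (inj₂ (inj₁ (_ , t≡b))) = inj₂ (inj₁ t≡b)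
      ... | inj₂ (inj₂ (inj₂ (_ , refl))) = ⊥-elim (proj₂ b<d refl)
      b⋖d : p ∋ b ⋖ d
      b⋖d = b<d , λ t (b≤t , t≤d) → endpoint b≤t (onChain (trans′ _ _ _ a≤b b≤t , t≤d))
        where
        endpoint : ∀ {t} → p ∋ b ≤ t → OneOf₃ c b d t → (t ≡ b) ⊎ (t ≡ d)
        endpoint b≤c (inj₁ refl) = ⊥-elim (<⇒≱ a<b b≤c)
        endpoint _ (inj₂ t∈bd) = t∈bd
      minC : Minimal p c
      minC = Minimal-remove p a b (λ b≡c → a≢b (sym b≡c)) minᵠc
      maxD : Maximal p d
      maxD = Maximal-remove p a b (proj₂ c<d) maxᵠd

    chain-cab-d≡b : d ≡ b → p ∋ c < a → PairThreeChain P a b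
    chain-cab-d≡b refl c<a =
      c , d , c⋖ᵠd , conn , c , a , d ,
      sameElements (inj₂ (inj₁ refl)) (inj₂ (inj₂ refl)) (inj₁ refl) (inj₂ (inj₂ refl))
                   (inj₂ (inj₂ (inj₁ refl))) (inj₁ refl) (inj₂ (inj₁ refl)) ,
      c⋖a , a⋖b , minC , maxD , (λ _ _ → onChain) , (λ (¬min , _) → ⊥-elim (¬min minC)) , (λ (_ , ¬max) → ⊥-elim (¬max maxD))
      where
      onChain : ∀ {t} → InInterval p c d t → OneOf₃ c a d t
      onChain t∈ with interval t∈
      ... | inj₁ t≡c = inj₁ t≡c
      ... | inj₂ (inj₁ t≡d) = inj₂ (inj₂ t≡d)
      ... | inj₂ (inj₂ (inj₁ (refl , _))) = ⊥-elim (proj₂ c<a refl)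
      ... | inj₂ (inj₂ (inj₂ (t≡a , _))) = inj₂ (inj₁ t≡a)
      c⋖a : p ∋ c ⋖ a
      c⋖a = c<a , λ t (c≤t , t≤a) → endpoint t≤a (onChain (c≤t , trans′ _ _ _ t≤a a≤b))
        where
        endpoint : ∀ {t} → p ∋ t ≤ a → OneOf₃ c a d t → (t ≡ c) ⊎ (t ≡ a)
        endpoint _ (inj₁ t≡c) = inj₁ t≡c
        endpoint _ (inj₂ (inj₁ t≡a)) = inj₂ t≡a
        endpoint d≤a (inj₂ (inj₂ refl)) = ⊥-elim (<⇒≱ a<b d≤a)
      minC : Minimal p c
      minC = Minimal-remove p a b (λ d≡c → proj₂ c<d (sym d≡c)) minᵠc
      maxD : Maximal p d
      maxD = Maximal-remove p a b a≢b maxᵠd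

    -- Since c is minimal in Q, the only element below c = b is a.
    chain-abd-c≡b : c ≡ b → p ∋ c ⋖ d → PairThreeChain P a b
    chain-abd-c≡b refl c⋖d =
      c , d , c⋖ᵠd , conn , a , c , d ,
      sameElements (inj₁ refl) (inj₂ (inj₁ refl)) (inj₂ (inj₁ refl)) (inj₂ (inj₂ refl))
                   (inj₁ refl) (inj₂ (inj₁ refl)) (inj₂ (inj₂ (inj₂ refl))) ,
      a⋖b , c⋖d , minA , maxD , (λ (minC , _) → ⊥-elim (<⇒¬Minimal p a<b minC)) ,
      (λ _ → inj₁ (a<b , λ s s<c → subst (λ s → p ∋ s ≤ a) (sym (below-c s<c)) (refl′ a))) ,
      (λ (_ , ¬max) → ⊥-elim (¬max maxD))
      where
      below-c : ∀ {s} → p ∋ s < c → s ≡ a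
      below-c (s≤c , s≢c) = proj₁ (remove-∉ p a b s≤c λ s≤ᵠc → s≢c (minᵠc _ s≤ᵠc))
      minA : Minimal p a
      minA s s≤a = decidable-stable (s ≟ a) λ s≢a → s≢a (below-c (<-trans (s≤a , s≢a) a<b))
      maxD : Maximal p d
      maxD = Maximal-remove p a b (proj₂ (<-trans a<b (proj₁ c⋖d))) maxᵠd

    -- Since d is maximal in Q, the only element above d = a is b.
    chain-cab-d≡a : d ≡ a → p ∋ c ⋖ d → Minimal p c → PairThreeChain P a b
    chain-cab-d≡a refl c⋖d minC =
      c , d , c⋖ᵠd , conn , c , d , b ,
      sameElements (inj₂ (inj₁ refl)) (inj₂ (inj₂ refl)) (inj₁ refl) (inj₂ (inj₁ refl))
                   (inj₂ (inj₂ (inj₁ refl))) (inj₁ refl) (inj₂ (inj₁ refl)) ,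
      c⋖d , a⋖b , minC , maxB , (λ (_ , maxD) → ⊥-elim (<⇒¬Maximal p a<b maxD)) ,
      (λ (¬min , _) → ⊥-elim (¬min minC)) ,
      (λ _ → inj₂ (a<b , λ s d<s → subst (λ s → p ∋ b ≤ s) (sym (above-d d<s)) (refl′ b)))
      where
      above-d : ∀ {s} → p ∋ d < s → s ≡ b
      above-d (d≤s , d≢s) = proj₂ (remove-∉ p a b d≤s λ d≤ᵠs → d≢s (sym (maxᵠd _ d≤ᵠs)))
      maxB : Maximal p b
      maxB s b≤s = decidable-stable (s ≟ b) λ s≢b →
        s≢b (above-d (<-trans a<b (b≤s , λ b≡s → s≢b (sym b≡s))))

    -- In the last case c ≺ d in P, yet P ∖ (c,d) ⊇ Q ∖ (c,d) is connected.
    pairThreeChain : HasFPPGraph P → PairThreeChain P a b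
    pairThreeChain (_ , separating) with ⋖-or-between c<d
    ... | inj₂ (z , c<z , z<d) with interval (proj₁ c<z , proj₁ z<d)
    ...   | inj₁ refl = ⊥-elim (proj₂ c<z refl)
    ...   | inj₂ (inj₁ refl) = ⊥-elim (proj₂ z<d refl)
    ...   | inj₂ (inj₂ (inj₁ (c≡a , refl))) = chain-abd-c≡a c≡a z<d
    ...   | inj₂ (inj₂ (inj₂ (refl , d≡b))) = chain-cab-d≡b d≡b c<z
    pairThreeChain (_ , separating) | inj₁ c⋖d with Minimal-or-∃< p c
    ... | inj₂ (t , t≤c , t≢c) = chain-abd-c≡b (proj₂ (remove-∉ p a b t≤c λ t≤ᵠc → t≢c (minᵠc _ t≤ᵠc))) c⋖d
    ... | inj₁ minC with Maximal-or-∃> p d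
    ...   | inj₂ (t , d≤t , d≢t) = chain-cab-d≡a (proj₁ (remove-∉ p a b d≤t λ d≤ᵠt → d≢t (sym (maxᵠd _ d≤ᵠt)))) c⋖d minC
    ...   | inj₁ maxD = ⊥-elim (separating c d (⋖∧Minimal∧Maximal⇒≺ p c⋖d minC maxD)
                          (Connected-mono (remove-mono (λ _ _ → remove-⊆ p a b) c d) conn))

theorem1 : (n : ℕ) (P : Poset (suc n)) →
    (ThreeChainProperty P → LShielded P) ×
    (HasFPPGraph P → LShielded P → ThreeChainProperty P)
theorem1 n P = shielded , threeChain
  where
  shielded : ThreeChainProperty P → LShielded P
  shielded tcp Q Q∈𝔏P fppQ with IsLowerCover⇒removeCover P Q Q∈𝔏P
  ... | a , b , a⋖b , Q⊑R , R⊑Q = PairThreeChain⇒¬HasFPPGraph P a⋖b (tcp a b a⋖b (proj₁ fppR)) fppR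
    where
    fppR : HasFPPGraph (removeCover P a⋖b)
    fppR = HasFPPGraph-cong {P = Q} {Q = removeCover P a⋖b} Q⊑R R⊑Q fppQ

  threeChain : HasFPPGraph P → LShielded P → ThreeChainProperty P
  threeChain fpp shielded a b a⋖b conn
    with ¬HasFPPGraph⇒∃≺-nonseparating Q (shielded Q (removeCover-isLowerCover P a⋖b)) conn
    where
    Q : Poset (suc n)
    Q = removeCover P a⋖b
  ... | _ , _ , c≺d , conn′ = NonseparatingPair.pairThreeChain P a⋖b c≺d conn′ fpp
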